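{- Let $\mathbb{F}$ be a field of characteristic $2$, and let $\mathcal{H}=(Q_0,Q_1,\beta)$ be an undirected graph encoded via the symmetric quadratic encoding, i.e. $\psi:Q_1\to2^{Q_0}$ with $1\le|\psi(e)|\le2$ and $\beta(e)=(2(v\otimes v),1)$ if $\psi(e)=\{v\}$, $\beta(e)=(u\otimes v+v\otimes u,1)$ if $\psi(e)=\{u,v\}$, $u\ne v$. Let $\rho:T(\mathbb{F}^{Q_0})\to\mathbb{F}^{Q_0}$ be the linear map with $\rho(1)=0$ and $\rho(u_1\otimes\cdots\otimes u_k)=u_1$ for $k\ge1$, $u_i\in Q_0$. Then $\mathrm{Ker}(\rho\circ\partial_\beta)=\mathrm{Ker}(B^{\mathrm{cl}})\subseteq\mathbb{F}^{Q_1}$.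
   Context: $T(\mathbb{F}^{Q_0})$ is the tensor algebra with standard basis $\{1\}\cup\{u_1\otimes\cdots\otimes u_k\}$, each $v\in Q_0$ identified with $\mathbf{1}_v$. $\partial_\beta:\mathbb{F}^{Q_1}\to T(\mathbb{F}^{Q_0})$, $\partial_\beta(\mathbf{1}_e)=B_e-A_e$ where $\beta(e)=(A_e,B_e)$. $B^{\mathrm{cl}}\in\{0,1\}^{Q_0\times Q_1}$ is the classical undirected incidence matrix: $B^{\mathrm{cl}}_{x,e}=1$ if $x\in\psi(e)$ and $e$ is not a loop ($|\psi(e)|=2$), and $0$ otherwise, viewed as a map $\mathbb{F}^{Q_1}\to\mathbb{F}^{Q_0}$. -}

module Defs where

open import Level using (Level; _⊔_)
open import Algebra.Bundles using (CommutativeRing)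
open import Data.Nat using (ℕ; zero; suc)
open import Data.Fin using (Fin; zero; suc)
open import Data.Fin.Properties using (_≟_)
open import Data.List using (List; []; _∷_; _++_)
open import Data.Product using (_×_; _,_; ∃)
open import Relation.Nullary using (¬_; yes; no)
open import Function.Bundles using (_⇔_)

record IsField {c ℓ} (R : CommutativeRing c ℓ) : Set (c ⊔ ℓ) where
  open CommutativeRing R hiding (zero)
  field
    0≉1     : ¬ (0# ≈ 1#)
    inverse : ∀ x → ¬ (x ≈ 0#) → ∃ λ y → x * y ≈ 1#

HasChar2 : ∀ {c ℓ} → CommutativeRing c ℓ → Set ℓ
HasChar2 R = 1# + 1# ≈ 0#
  where open CommutativeRing R

-- An undirected graph with vertex set Q₀ = Fin n and edge set Q₁ = Fin m.
-- ψ e = (u , v) encodes the endpoint set ψ(e) = {u, v}; e is a loop iff u ≡ v.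
-- (Every 1- or 2-element subset of Q₀ arises this way.)
Graph : ℕ → ℕ → Set
Graph n m = Fin m → Fin n × Fin n

module _ {c ℓ} (R : CommutativeRing c ℓ) where
  open CommutativeRing R hiding (zero)

  Σ[_] : ∀ {k} → (Fin k → Carrier) → Carrier
  Σ[_] {zero}  f = 0#
  Σ[_] {suc k} f = f zero + Σ[_] (λ i → f (suc i))

  Vec𝔽 : ℕ → Set c
  Vec𝔽 k = Fin k → Carrier

  IsZero : ∀ {k} → Vec𝔽 k → Set ℓ
  IsZero v = ∀ i → v i ≈ 0#

  -- Elements of the tensor algebra T(F^{Q₀}) written as formal linear
  -- combinations of standard basis words: the word [] is the unit 1 and
  -- u₁ ∷ … ∷ u_k is u₁ ⊗ ⋯ ⊗ u_k.
  Tensor : ℕ → Set c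
  Tensor n = List (Carrier × List (Fin n))

  scaleT : ∀ {n} → Carrier → Tensor n → Tensor n
  scaleT a [] = []
  scaleT a ((b , w) ∷ t) = (a * b , w) ∷ scaleT a t

  𝟏 : ∀ {n} → Fin n → Vec𝔽 n
  𝟏 u v with u ≟ v
  ... | yes _ = 1#
  ... | no  _ = 0#

  ρword : ∀ {n} → List (Fin n) → Vec𝔽 n
  ρword []      v = 0#
  ρword (u ∷ _) v = 𝟏 u v

  ρ : ∀ {n} → Tensor n → Vec𝔽 n
  ρ [] v = 0#
  ρ ((a , w) ∷ t) v = a * ρword w v + ρ t v

  A : ∀ {n m} → Graph n m → Fin m → Tensor n
  A ψ e with ψ e
  ... | (u , v) with u ≟ v
  ...   | yes _ = (1# + 1# , u ∷ u ∷ []) ∷ []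
  ...   | no  _ = (1# , u ∷ v ∷ []) ∷ (1# , v ∷ u ∷ []) ∷ []

  B : ∀ {n m} → Graph n m → Fin m → Tensor n
  B ψ e = (1# , []) ∷ []

  ∂ : ∀ {n m} → Graph n m → Vec𝔽 m → Tensor n
  ∂ {m = zero}  ψ x = []
  ∂ {m = suc m} ψ x =
    scaleT (x zero) (B ψ zero ++ scaleT (- 1#) (A ψ zero))
    ++ ∂ (λ e → ψ (suc e)) (λ e → x (suc e))

  Bcl-entry : ∀ {n m} → Graph n m → Fin n → Fin m → Carrier
  Bcl-entry ψ x e with ψ e
  ... | (u , v) with u ≟ v
  ...   | yes _ = 0#
  ...   | no  _ with x ≟ u | x ≟ v
  ...     | no _ | no _ = 0#
  ...     | _    | _    = 1#

  Bcl : ∀ {n m} → Graph n m → Vec𝔽 m → Vec𝔽 n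
  Bcl ψ y x = Σ[ (λ e → Bcl-entry ψ x e * y e) ]

  Ker-ρ∂ : ∀ {n m} → Graph n m → Vec𝔽 m → Set ℓ
  Ker-ρ∂ ψ y = IsZero (ρ (∂ ψ y))

  Ker-Bcl : ∀ {n m} → Graph n m → Vec𝔽 m → Set ℓ
  Ker-Bcl ψ y = IsZero (Bcl ψ y)

module Submission where

open import Defs
open import Algebra.Bundles using (CommutativeRing)
open import Data.Nat using (zero; suc)
open import Data.Fin using (Fin; zero; suc)
open import Data.Fin.Properties using (_≟_)
open import Data.List using ([]; _∷_; _++_)
open import Data.Product using (_,_)
open import Data.Empty using (⊥-elim)
open import Relation.Nullary using (yes; no)
open import Relation.Binary.PropositionalEquality as ≡ using (_≢_)
open import Function.Bundles using (_⇔_; mk⇔)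
import Algebra.Properties.Ring as RingProperties
import Relation.Binary.Reasoning.Setoid as SetoidReasoning

-- ρ kills the unit B_e = 1, so ρ(∂_β y) = −Σ_e y_e ρ(A_e). Evaluated at a vertex x,
-- ρ(A_e) is 1 + 1 = 0 on a loop and the indicator of x ∈ {u, v} on a non-loop,
-- i.e. exactly the column of B^cl; in characteristic 2 the sign disappears.
-- Hence ρ ∘ ∂_β = B^cl as linear maps, so their kernels agree.

module _ {c ℓ} (R : CommutativeRing c ℓ) where
  open CommutativeRing R hiding (zero)
  open RingProperties ring using (+-inverseʳ-unique)
  open SetoidReasoning setoid

  ρ-++ : ∀ {n} (s t : Tensor R n) v → ρ R (s ++ t) v ≈ ρ R s v + ρ R t v
  ρ-++ []            t v = sym (+-identityˡ _)
  ρ-++ ((a , w) ∷ s) t v = trans (+-congˡ (ρ-++ s t v)) (sym (+-assoc _ _ _))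

  ρ-scaleT : ∀ {n} a (t : Tensor R n) v → ρ R (scaleT R a t) v ≈ a * ρ R t v
  ρ-scaleT a []            v = sym (zeroʳ _)
  ρ-scaleT a ((b , w) ∷ t) v = begin
    a * b * ρword R w v + ρ R (scaleT R a t) v ≈⟨ +-cong (*-assoc _ _ _) (ρ-scaleT a t v) ⟩
    a * (b * ρword R w v) + a * ρ R t v        ≈⟨ distribˡ _ _ _ ⟨
    a * (b * ρword R w v + ρ R t v)            ∎

  ρ-B : ∀ {n m} (ψ : Graph n m) e x → ρ R (B R ψ e) x ≈ 0#
  ρ-B ψ e x = trans (+-identityʳ _) (zeroʳ _)

  𝟏-diag : ∀ {n} (u : Fin n) → 𝟏 R u u ≈ 1#
  𝟏-diag u with u ≟ u
  ... | yes _   = refl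
  ... | no  u≢u = ⊥-elim (u≢u ≡.refl)

  𝟏-off-diag : ∀ {n} {u x : Fin n} → x ≢ u → 𝟏 R u x ≈ 0#
  𝟏-off-diag {u = u} {x} x≢u with u ≟ x
  ... | yes ≡.refl = ⊥-elim (x≢u ≡.refl)
  ... | no  _       = refl

  unit-combination≈ : ∀ {a b p q r} → a ≈ p → b ≈ q → p + q ≈ r → 1# * a + (1# * b + 0#) ≈ r
  unit-combination≈ a≈p b≈q p+q≈r =
    trans (+-cong (trans (*-identityˡ _) a≈p) (trans (+-identityʳ _) (trans (*-identityˡ _) b≈q)))
          p+q≈r

  module Char2 (char2 : HasChar2 R) where

    -1≈1 : - 1# ≈ 1#
    -1≈1 = sym (+-inverseʳ-unique 1# 1# char2)

    ρ-A : ∀ {n m} (ψ : Graph n m) e x → ρ R (A R ψ e) x ≈ Bcl-entry R ψ x e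
    ρ-A ψ e x with ψ e
    ... | (u , v) with u ≟ v
    ...   | yes _ = trans (+-identityʳ _) (trans (*-congʳ char2) (zeroˡ _))
    ...   | no u≢v with x ≟ u | x ≟ v
    ...     | yes ≡.refl | yes ≡.refl = ⊥-elim (u≢v ≡.refl)
    ...     | yes ≡.refl | no x≢v     = unit-combination≈ (𝟏-diag u) (𝟏-off-diag x≢v) (+-identityʳ _)
    ...     | no x≢u     | yes ≡.refl = unit-combination≈ (𝟏-off-diag x≢u) (𝟏-diag v) (+-identityˡ _)
    ...     | no x≢u     | no x≢v     = unit-combination≈ (𝟏-off-diag x≢u) (𝟏-off-diag x≢v) (+-identityˡ _)

    ρ-edge : ∀ {n m} (ψ : Graph n m) e a x →
             ρ R (scaleT R a (B R ψ e ++ scaleT R (- 1#) (A R ψ e))) x ≈ Bcl-entry R ψ x e * a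
    ρ-edge ψ e a x = begin
      ρ R (scaleT R a (B R ψ e ++ scaleT R (- 1#) (A R ψ e))) x
        ≈⟨ ρ-scaleT a (B R ψ e ++ scaleT R (- 1#) (A R ψ e)) x ⟩
      a * ρ R (B R ψ e ++ scaleT R (- 1#) (A R ψ e)) x
        ≈⟨ *-congˡ (ρ-++ (B R ψ e) (scaleT R (- 1#) (A R ψ e)) x) ⟩
      a * (ρ R (B R ψ e) x + ρ R (scaleT R (- 1#) (A R ψ e)) x)
        ≈⟨ *-congˡ (+-cong (ρ-B ψ e x) (ρ-scaleT (- 1#) (A R ψ e) x)) ⟩
      a * (0# + - 1# * ρ R (A R ψ e) x)
        ≈⟨ *-congˡ (trans (+-identityˡ _) (trans (*-congʳ -1≈1) (*-identityˡ _))) ⟩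
      a * ρ R (A R ψ e) x
        ≈⟨ *-comm a _ ⟩
      ρ R (A R ψ e) x * a
        ≈⟨ *-congʳ (ρ-A ψ e x) ⟩
      Bcl-entry R ψ x e * a
        ∎

    ρ∘∂≈Bcl : ∀ {n m} (ψ : Graph n m) y x → ρ R (∂ R ψ y) x ≈ Bcl R ψ y x
    ρ∘∂≈Bcl {m = zero}  ψ y x = refl
    ρ∘∂≈Bcl {n} {suc m} ψ y x =
      trans (ρ-++ (scaleT R (y zero) (B R ψ zero ++ scaleT R (- 1#) (A R ψ zero))) (∂ R ψ′ y′) x)
            (+-cong (ρ-edge ψ zero (y zero) x) (ρ∘∂≈Bcl ψ′ y′ x))
      where
      ψ′ : Graph n m
      ψ′ e = ψ (suc e)
      y′ : Vec𝔽 R m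
      y′ e = y (suc e)

theorem5p7 : ∀ {c ℓ} (R : CommutativeRing c ℓ) → IsField R → HasChar2 R →
    ∀ {n m} (ψ : Graph n m) (y : Vec𝔽 R m) →
    Ker-ρ∂ R ψ y ⇔ Ker-Bcl R ψ y
theorem5p7 R _ char2 ψ y =
  mk⇔ (λ ρ∂y≈0 x → trans (sym (ρ∘∂≈Bcl ψ y x)) (ρ∂y≈0 x))
      (λ Bcly≈0 x → trans (ρ∘∂≈Bcl ψ y x) (Bcly≈0 x))
  where
  open CommutativeRing R using (trans; sym)
  open Char2 R char2 using (ρ∘∂≈Bcl)
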